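{- Let $G$ be a graph, $S\subseteq V(G)$, $\mathcal W=(T,(W_x\mid x\in V(T)))$ a tree decomposition of $(G,S)$, and $\mathcal F$ a family of connected subgraphs of $G$ each of which intersects $S$. Then for every positive integer $k$, either (1) there are $k$ pairwise vertex-disjoint members of $\mathcal F$, or (2) there is a set $Z\subseteq V(G)$ which is the union of at most $k-1$ bags of $\mathcal W$ such that $V(F)\cap Z\neq\emptyset$ for every $F\in\mathcal F$.
   Context: A tree decomposition of a graph $H$ is a pair $(T,(W_x\mid x\in V(T)))$ with $T$ a non-null tree and bags $W_x\subseteq V(H)$ such that each edge of $H$ lies in some bag and for each vertex $v$ the set $\{x: v\in W_x\}$ induces a non-empty subtree of $T$. A tree decomposition of $(G,S)$ is a tree decomposition of some induced subgraph $H$ of $G$ with $S\subseteq V(H)$ such that for every component $C$ of $G-V(H)$ some bag contains all neighbours of $V(C)$ in $G$. -}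

module Defs where

open import Data.Nat using (ℕ; suc; _≤_; _∸_)
open import Data.Bool using (Bool; true)
open import Data.Fin using (Fin)
open import Data.Fin.Subset using (Subset; _∈_; _∉_; _⊆_; _∩_; ⋃; Nonempty; Empty)
open import Data.List using (List; []; _∷_; _++_; length; map)
open import Data.List.Relation.Unary.Unique.Propositional using (Unique)
open import Data.List.Relation.Unary.Linked using (Linked)
open import Data.Product using (Σ; ∃; _×_)
open import Relation.Binary.PropositionalEquality using (_≡_; _≢_)
open import Relation.Nullary using (¬_)

record Graph (n : ℕ) : Set where
  field
    adj     : Fin n → Fin n → Bool
    adj-sym : ∀ u v → adj u v ≡ adj v u
    adj-irr : ∀ u → ¬ (adj u u ≡ true)

open Graph public

Adj : ∀ {n} → Graph n → Fin n → Fin n → Set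
Adj G u v = adj G u v ≡ true

data WalkIn {n} (R : Fin n → Fin n → Set) (X : Fin n → Set) : Fin n → Fin n → Set where
  here : ∀ {u} → X u → WalkIn R X u u
  step : ∀ {u v w} → X u → R u v → WalkIn R X v w → WalkIn R X u w

ConnectedIn : ∀ {n} → (Fin n → Fin n → Set) → (Fin n → Set) → Set
ConnectedIn R X = (∃ λ u → X u) × (∀ u v → X u → X v → WalkIn R X u v)

HasCycle : ∀ {n} → Graph n → Set
HasCycle {n} G = Σ (Fin n) λ v → Σ (List (Fin n)) λ ws →
  (2 ≤ length ws) × Unique (v ∷ ws) × Linked (Adj G) (v ∷ ws ++ v ∷ [])

IsTree : ∀ {n} → Graph n → Set
IsTree G = ConnectedIn (Adj G) (λ _ → Data.Unit.⊤) × ¬ HasCycle G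
  where import Data.Unit

IsComponentOfMinus : ∀ {n} → Graph n → Subset n → Subset n → Set
IsComponentOfMinus G U C =
  (∀ v → v ∈ C → v ∉ U) ×
  ConnectedIn (Adj G) (_∈ C) ×
  (∀ u v → u ∈ C → v ∉ U → Adj G u v → v ∈ C)

-- Tree decomposition of (G, S): a tree decomposition of the induced subgraph
-- H = G[U] with S ⊆ U, such that the neighbourhood of every component of
-- G - U lies in some bag.
record TreeDecomposition {n} (G : Graph n) (S : Subset n) : Set where
  field
    m        : ℕ
    T        : Graph m
    T-tree   : IsTree T
    U        : Subset n
    S⊆U      : S ⊆ U
    W        : Fin m → Subset n
    W⊆U      : ∀ x → W x ⊆ U
    edge-cov : ∀ u v → u ∈ U → v ∈ U → Adj G u v →
               ∃ λ x → u ∈ W x × v ∈ W x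
    subtree  : ∀ v → v ∈ U → ConnectedIn (Adj T) (λ x → v ∈ W x)
    comp-cov : ∀ C → IsComponentOfMinus G U C →
               ∃ λ x → ∀ u → u ∉ C → (∃ λ v → v ∈ C × Adj G u v) → u ∈ W x

record Subgraph {n} (G : Graph n) : Set where
  field
    V     : Subset n
    E     : Fin n → Fin n → Bool
    E-sym : ∀ u v → E u v ≡ E v u
    E⊆    : ∀ u v → E u v ≡ true → Adj G u v × u ∈ V × v ∈ V

open Subgraph public

ConnectedSubgraph : ∀ {n} {G : Graph n} → Subgraph G → Set
ConnectedSubgraph F = ConnectedIn (λ u v → E F u v ≡ true) (_∈ V F)

{-# OPTIONS --safe #-}
-- For a member F, let T_F be the set of nodes whose bag meets F. Every vertex v of G has an
-- anchor node: a bag containing v if v ∈ U, otherwise a bag containing the neighbourhood of the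
-- component of G − U containing v. As F is connected and meets S ⊆ U, the anchors of the vertices
-- of F lie in T_F, and consecutive vertices of a walk in F have anchors joined inside T_F. Hence
-- T_F is a subtree of T, and members with disjoint subtrees are disjoint, since a common vertex
-- would have its anchor in both.
--
-- It remains to show that for subtrees of a tree either k are pairwise disjoint or k − 1 nodes
-- meet all of them. Remove a leaf ℓ of what is left of the tree. If some subtree meets it only in
-- ℓ, that subtree joins the packing, ℓ joins the transversal, and every subtree through ℓ is
-- dropped. Otherwise every subtree through ℓ also contains the unique remaining neighbour of ℓ,
-- so deleting ℓ changes neither connectedness nor disjointness.
module Submission where

open import Defs
open import Data.Nat using (ℕ; zero; suc; _+_; _≤_; _<_; _∸_; z≤n; s≤s)
open import Data.Nat.Properties using (≤-pred; <⇒≱; m≤m+n; +-suc)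
open import Data.Fin using (Fin; zero; suc; _≟_)
open import Data.Fin.Properties using (any?; all?; injective⇒≤)
open import Data.Fin.Subset
  using (Subset; inside; outside; _∈_; _∉_; _∩_; _∪_; _─_; _-_; ⁅_⁆; ⊤; _⊆_; _⊂_; _⊃_; ⋃;
         Nonempty; Empty)
open import Data.Fin.Subset.Properties
  using (_∈?_; nonempty?; ∈⊤; x∈⁅x⁆; x∈⁅y⁆⇒x≡y; x∈p∩q⁺; x∈p∩q⁻; x∈p∪q⁺; x∈p∪q⁻; p⊆p∪q;
         x∈p∧x≢y⇒x∈p-y; p─q⊆p; x∈p⇒p-x⊂p)
open import Data.Fin.Subset.Induction using (Acc; acc; ⊂-wellFounded; ⊃-wellFounded)
open import Data.Vec using (_∷_; here; there)
import Data.Vec.Functional as Vector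
open import Data.List using (List; []; _∷_; _++_; length; map; head; lookup)
open import Data.List.Properties using (length-++-sucʳ)
open import Data.List.Membership.Propositional.Properties using (∈-∃++; ∈-lookup)
open import Data.List.Relation.Unary.All using (All; []; _∷_)
import Data.List.Relation.Unary.All as All
open import Data.List.Relation.Unary.All.Properties using (¬Any⇒All¬)
open import Data.List.Relation.Unary.Any using (Any; here; there)
open import Data.List.Relation.Unary.AllPairs using ([]; _∷_)
open import Data.List.Relation.Unary.Unique.Propositional using (Unique)
open import Data.List.Relation.Unary.Linked using (Linked; []; [-]; _∷_)
import Data.List.Membership.Propositional as List
open import Data.Maybe using (just)
import Data.Maybe.Properties as Maybe
open import Data.Product using (Σ; ∃; ∃₂; _×_; _,_; proj₁; proj₂)
open import Data.Sum using (_⊎_; inj₁; inj₂)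
import Data.Sum as Sum
open import Data.Empty using (⊥; ⊥-elim)
open import Data.Unit using (tt)
import Data.Unit as Unit
open import Data.Bool using (true)
import Data.Bool as Bool
open import Function using (id; _∘_)
open import Function.Definitions using (Injective)
open import Relation.Nullary using (¬_; Dec; yes; no; ¬?)
open import Relation.Nullary.Decidable using (_×-dec_; _→-dec_; decidable-stable)
open import Relation.Binary.PropositionalEquality using (_≡_; _≢_; refl; sym; trans; subst; cong)

x∈p─q⇒x∉q : ∀ {n} (p q : Subset n) {x} → x ∈ p ─ q → x ∉ q
x∈p─q⇒x∉q (inside ∷ p) (outside ∷ q) here ()
x∈p─q⇒x∉q (_ ∷ p)      (_ ∷ q)       (there x∈p─q) (there x∈q) =
  x∈p─q⇒x∉q p q x∈p─q x∈q

x∈p-y⇒x≢y : ∀ {n} {p : Subset n} {x y} → x ∈ p - y → x ≢ y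
x∈p-y⇒x≢y {p = p} {y = y} x∈p-y refl = x∈p─q⇒x∉q p ⁅ y ⁆ x∈p-y (x∈⁅x⁆ y)

module _ {a} {A : Set a} where

  all-prefix : ∀ {q} {P : A → Set q} (xs : List A) {w ys} →
               All P (xs ++ w ∷ ys) → All P (xs ++ w ∷ [])
  all-prefix []       (Pw ∷ _)   = Pw ∷ []
  all-prefix (x ∷ xs) (Px ∷ Pxs) = Px ∷ all-prefix xs Pxs

  unique-prefix : ∀ (xs : List A) {w ys} → Unique (xs ++ w ∷ ys) → Unique (xs ++ w ∷ [])
  unique-prefix []       (_ ∷ _)      = [] ∷ []
  unique-prefix (x ∷ xs) (x∉ ∷ uniq) = all-prefix xs x∉ ∷ unique-prefix xs uniq

  linked-close : ∀ {r} {R : A → A → Set r} (xs : List A) {w ys c} →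
                 Linked R (xs ++ w ∷ ys) → R w c → Linked R ((xs ++ w ∷ []) ++ c ∷ [])
  linked-close []           _            wc = wc ∷ [-]
  linked-close (x ∷ [])     (xw ∷ _)     wc = xw ∷ wc ∷ [-]
  linked-close (x ∷ y ∷ xs) (xy ∷ linked) wc = xy ∷ linked-close (y ∷ xs) linked wc

lookup-injective : ∀ {a} {A : Set a} {xs : List A} → Unique xs → Injective _≡_ _≡_ (lookup xs)
lookup-injective {xs = _ ∷ _} (_ ∷ _)    {zero}  {zero}  _ = refl
lookup-injective {xs = _ ∷ _} (x∉ ∷ _)   {zero}  {suc j} e = ⊥-elim (All.lookup x∉ (∈-lookup j) e)
lookup-injective {xs = _ ∷ _} (x∉ ∷ _)   {suc i} {zero}  e = ⊥-elim (All.lookup x∉ (∈-lookup i) (sym e))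
lookup-injective {xs = _ ∷ _} (_ ∷ uniq) {suc i} {suc j} e = cong suc (lookup-injective uniq e)

unique⇒length≤ : ∀ {m} {xs : List (Fin m)} → Unique xs → length xs ≤ m
unique⇒length≤ uniq = injective⇒≤ (lookup-injective uniq)

module _ {n} {R : Fin n → Fin n → Set} where

  walk-source : ∀ {X u v} → WalkIn R X u v → X u
  walk-source (here Xu)     = Xu
  walk-source (step Xu _ _) = Xu

  walk-map : ∀ {X Y : Fin n → Set} → (∀ {x} → X x → Y x) →
             ∀ {u v} → WalkIn R X u v → WalkIn R Y u v
  walk-map f (here Xu)         = here (f Xu)
  walk-map f (step Xu uv rest) = step (f Xu) uv (walk-map f rest)

  infixr 5 _++ʷ_
  _++ʷ_ : ∀ {X u v w} → WalkIn R X u v → WalkIn R X v w → WalkIn R X u w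
  here _          ++ʷ q = q
  step Xu uv rest ++ʷ q = step Xu uv (rest ++ʷ q)

  connected-≐ : ∀ {X Y : Fin n → Set} → (∀ {x} → X x → Y x) → (∀ {x} → Y x → X x) →
                ConnectedIn R X → ConnectedIn R Y
  connected-≐ X⊆Y Y⊆X ((u , Xu) , walk) =
    (u , X⊆Y Xu) , λ v w Yv Yw → walk-map X⊆Y (walk v w (Y⊆X Yv) (Y⊆X Yw))

  first-step : ∀ {X u v} → WalkIn R X u v → u ≢ v → ∃ λ w → X w × R u w
  first-step (here _)         u≢u = ⊥-elim (u≢u refl)
  first-step (step _ uw rest) _   = _ , walk-source rest , uw

  connected-⁅⁆ : ∀ {v} → ConnectedIn R (_∈ ⁅ v ⁆)
  connected-⁅⁆ {v} = (v , x∈⁅x⁆ v) , walk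
    where
    walk : ∀ a b → a ∈ ⁅ v ⁆ → b ∈ ⁅ v ⁆ → WalkIn R (_∈ ⁅ v ⁆) a b
    walk a b a∈⁅v⁆ b∈⁅v⁆ rewrite x∈⁅y⁆⇒x≡y v a∈⁅v⁆ | x∈⁅y⁆⇒x≡y v b∈⁅v⁆ =
      here (x∈⁅x⁆ v)

  walk-exit : ∀ {X} (C : Subset n) {u v} → WalkIn R X u v → u ∈ C → v ∉ C →
              ∃₂ λ c w → c ∈ C × w ∉ C × X w × R c w
  walk-exit C (here _) u∈C u∉C = ⊥-elim (u∉C u∈C)
  walk-exit C (step {v = w} _ uw rest) u∈C v∉C with w ∈? C
  ... | yes w∈C = walk-exit C rest w∈C v∉C
  ... | no  w∉C = _ , w , u∈C , w∉C , walk-source rest , uw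

module _ {n} (G : Graph n) where

  Adj-sym : ∀ {u v} → Adj G u v → Adj G v u
  Adj-sym {u} {v} uv = trans (adj-sym G v u) uv

  Adj⇒≢ : ∀ {u v} → Adj G u v → u ≢ v
  Adj⇒≢ {v = v} uv refl = adj-irr G v uv

  connected-∪⁅⁆ : ∀ {C c w} → ConnectedIn (Adj G) (_∈ C) → c ∈ C → Adj G c w →
                  ConnectedIn (Adj G) (_∈ C ∪ ⁅ w ⁆)
  connected-∪⁅⁆ {C} {c} {w} ((u , u∈C) , walk) c∈C cw = (u , ⊆∪ u∈C) , walk′
    where
    ⊆∪ : C ⊆ C ∪ ⁅ w ⁆
    ⊆∪ = p⊆p∪q ⁅ w ⁆
    w∈ : w ∈ C ∪ ⁅ w ⁆
    w∈ = x∈p∪q⁺ (inj₂ (x∈⁅x⁆ w))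
    walk′ : ∀ a b → a ∈ C ∪ ⁅ w ⁆ → b ∈ C ∪ ⁅ w ⁆ → WalkIn (Adj G) (_∈ C ∪ ⁅ w ⁆) a b
    walk′ a b a∈ b∈ with x∈p∪q⁻ C ⁅ w ⁆ a∈ | x∈p∪q⁻ C ⁅ w ⁆ b∈
    ... | inj₁ a∈C   | inj₁ b∈C   = walk-map ⊆∪ (walk a b a∈C b∈C)
    ... | inj₁ a∈C   | inj₂ b∈⁅w⁆ rewrite x∈⁅y⁆⇒x≡y w b∈⁅w⁆ =
      walk-map ⊆∪ (walk a c a∈C c∈C) ++ʷ step (⊆∪ c∈C) cw (here w∈)
    ... | inj₂ a∈⁅w⁆ | inj₁ b∈C   rewrite x∈⁅y⁆⇒x≡y w a∈⁅w⁆ =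
      step w∈ (Adj-sym cw) (walk-map ⊆∪ (walk c b c∈C b∈C))
    ... | inj₂ a∈⁅w⁆ | inj₂ b∈⁅w⁆ rewrite x∈⁅y⁆⇒x≡y w a∈⁅w⁆ | x∈⁅y⁆⇒x≡y w b∈⁅w⁆ =
      here w∈

  -- Isolated vertices count as leaves.
  LeafIn : (Fin n → Set) → Fin n → Set
  LeafIn X ℓ = ∀ {u v} → X u → X v → Adj G ℓ u → Adj G ℓ v → u ≡ v

  avoid-leaf : ∀ {X ℓ} → LeafIn X ℓ → ∀ {u v} → WalkIn (Adj G) X u v → u ≢ ℓ → v ≢ ℓ →
               WalkIn (Adj G) (λ x → X x × x ≢ ℓ) u v
  avoid-leaf leaf (here Xu) u≢ℓ _ = here (Xu , u≢ℓ)
  avoid-leaf {ℓ = ℓ} leaf (step {v = c} Xu uc rest) u≢ℓ v≢ℓ with c ≟ ℓ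
  ... | no c≢ℓ = step (Xu , u≢ℓ) uc (avoid-leaf leaf rest c≢ℓ v≢ℓ)
  avoid-leaf leaf (step Xu uc (here _)) u≢ℓ v≢ℓ | yes refl = ⊥-elim (v≢ℓ refl)
  avoid-leaf leaf (step Xu uc (step _ ℓd rest)) u≢ℓ v≢ℓ | yes refl
    with leaf (walk-source rest) Xu ℓd (Adj-sym uc)
  ... | refl = avoid-leaf leaf rest u≢ℓ v≢ℓ

module _ {m} (T : Graph m) (acyclic : ¬ HasCycle T) where

  chord⇒cycle : ∀ {c q w ps} → Unique (c ∷ q ∷ ps) → Linked (Adj T) (c ∷ q ∷ ps) →
                Adj T c w → w List.∈ ps → HasCycle T
  chord⇒cycle {c} {q} {w} uniq linked cw w∈ps with ∈-∃++ w∈ps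
  ... | xs , ys , refl =
    c , q ∷ xs ++ w ∷ [] , s≤s (subst (1 ≤_) (sym (length-++-sucʳ xs w [])) (s≤s z≤n)) ,
    unique-prefix (c ∷ q ∷ xs) uniq , linked-close (c ∷ q ∷ xs) linked (Adj-sym T cw)

  private
    extension-fresh : ∀ {c w} ps → Unique (c ∷ ps) → Linked (Adj T) (c ∷ ps) →
                      Adj T c w → head ps ≢ just w → w List.∉ c ∷ ps
    extension-fresh _       _    _      cw _        (here w≡c)           = Adj⇒≢ T cw (sym w≡c)
    extension-fresh (_ ∷ _) _    _      _  not-back (there (here refl))  = not-back refl
    extension-fresh (_ ∷ _) uniq linked cw _        (there (there w∈ps)) =
      acyclic (chord⇒cycle uniq linked cw w∈ps)

    back? : (ps : List (Fin m)) (w : Fin m) → Dec (head ps ≡ just w)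
    back? ps w = Maybe.≡-dec _≟_ (head ps) (just w)

  leaf-exists : (Y : Subset m) → ∀ {y} → y ∈ Y → ∃ λ ℓ → ℓ ∈ Y × LeafIn T (_∈ Y) ℓ
  leaf-exists Y y∈Y = extend (suc m) [] ([] ∷ []) [-] y∈Y (s≤s (m≤m+n m 1))
    where
    -- c ∷ ps is a path ending in c, listed backwards; it is extended until c is a leaf of Y.
    extend : ∀ fuel {c} ps → Unique (c ∷ ps) → Linked (Adj T) (c ∷ ps) → c ∈ Y →
             m < fuel + length (c ∷ ps) → ∃ λ ℓ → ℓ ∈ Y × LeafIn T (_∈ Y) ℓ
    extend zero       ps uniq _ _ m<len = ⊥-elim (<⇒≱ m<len (unique⇒length≤ uniq))
    extend (suc fuel) {c} ps uniq linked c∈Y bound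
      with any? (λ w → w ∈? Y ×-dec adj T c w Bool.≟ true ×-dec ¬? (back? ps w))
    ... | no none =
      c , c∈Y , λ u∈Y v∈Y cu cv → Maybe.just-injective (trans (sym (back u∈Y cu)) (back v∈Y cv))
      where
      back : ∀ {w} → w ∈ Y → Adj T c w → head ps ≡ just w
      back {w} w∈Y cw = decidable-stable (back? ps w) (λ not-back → none (w , w∈Y , cw , not-back))
    ... | yes (w , w∈Y , cw , not-back) =
      extend fuel (c ∷ ps) (¬Any⇒All¬ (c ∷ ps) (extension-fresh ps uniq linked cw not-back) ∷ uniq)
             (Adj-sym T cw ∷ linked) w∈Y (subst (m <_) (sym (+-suc fuel (length (c ∷ ps)))) bound)

module _ {n} (G : Graph n) (U : Subset n) where

  private
    Escape : Subset n → Fin n → Set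
    Escape C w = w ∉ U × w ∉ C × ∃ λ c → c ∈ C × Adj G c w

    escape? : ∀ C w → Dec (Escape C w)
    escape? C w =
      ¬? (w ∈? U) ×-dec ¬? (w ∈? C) ×-dec any? (λ c → c ∈? C ×-dec adj G c w Bool.≟ true)

    grow : ∀ {C} → Acc _⊃_ C → (∀ v → v ∈ C → v ∉ U) → ConnectedIn (Adj G) (_∈ C) →
           ∃ λ C′ → C ⊆ C′ × IsComponentOfMinus G U C′
    grow {C} (acc larger) C∩U=∅ C-connected with any? (escape? C)
    ... | no none = C , id , C∩U=∅ , C-connected , closed
      where
      closed : ∀ u v → u ∈ C → v ∉ U → Adj G u v → v ∈ C
      closed u v u∈C v∉U uv =
        decidable-stable (v ∈? C) (λ v∉C → none (v , v∉U , v∉C , u , u∈C , uv))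
    ... | yes (w , w∉U , w∉C , c , c∈C , cw) =
      let C′ , C∪w⊆C′ , component =
            grow (larger C⊂C∪w) C∪w∩U=∅ (connected-∪⁅⁆ G C-connected c∈C cw)
      in  C′ , C∪w⊆C′ ∘ p⊆p∪q ⁅ w ⁆ , component
      where
      C⊂C∪w : C ⊂ C ∪ ⁅ w ⁆
      C⊂C∪w = p⊆p∪q ⁅ w ⁆ , w , x∈p∪q⁺ (inj₂ (x∈⁅x⁆ w)) , w∉C
      C∪w∩U=∅ : ∀ v → v ∈ C ∪ ⁅ w ⁆ → v ∉ U
      C∪w∩U=∅ v v∈ with x∈p∪q⁻ C ⁅ w ⁆ v∈
      ... | inj₁ v∈C = C∩U=∅ v v∈C
      ... | inj₂ v∈⁅w⁆ rewrite x∈⁅y⁆⇒x≡y w v∈⁅w⁆ = w∉U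

  component-containing : ∀ {v} → v ∉ U → ∃ λ C → IsComponentOfMinus G U C × v ∈ C
  component-containing {v} v∉U =
    let C , v⊆C , component = grow (⊃-wellFounded ⁅ v ⁆) ⁅v⁆∩U=∅ connected-⁅⁆
    in  C , component , v⊆C (x∈⁅x⁆ v)
    where
    ⁅v⁆∩U=∅ : ∀ u → u ∈ ⁅ v ⁆ → u ∉ U
    ⁅v⁆∩U=∅ u u∈⁅v⁆ rewrite x∈⁅y⁆⇒x≡y v u∈⁅v⁆ = v∉U

module SubtreeHelly {m} (T : Graph m) (acyclic : ¬ HasCycle T)
                    {p} (A : Fin p → Fin m → Set) (A? : ∀ i x → Dec (A i x)) where

  -- Y is the part of T still present and act the members still in play.
  Trace : Subset m → Fin p → Fin m → Set
  Trace Y i x = x ∈ Y × A i x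

  Subtrees : Subset m → (Fin p → Set) → Set
  Subtrees Y act = ∀ {i} → act i → ConnectedIn (Adj T) (Trace Y i)

  Packing : Subset m → (Fin p → Set) → ℕ → Set
  Packing Y act k = Σ (Fin k → Fin p) λ f → (∀ j → act (f j)) ×
    (∀ j j′ → j ≢ j′ → ∀ {x} → x ∈ Y → A (f j) x → A (f j′) x → ⊥)

  Transversal : (Fin p → Set) → ℕ → Set
  Transversal act k = Σ (List (Fin m)) λ xs → length xs < k × (∀ {i} → act i → Any (A i) xs)

  SingletonTrace : Subset m → (Fin p → Set) → Fin m → Set
  SingletonTrace Y act ℓ = ∃ λ i → act i × A i ℓ × (∀ w → w ∈ Y → A i w → w ≡ ℓ)

  singletonTrace? : ∀ Y {act} → (∀ i → Dec (act i)) → ∀ ℓ → Dec (SingletonTrace Y act ℓ)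
  singletonTrace? Y act? ℓ =
    any? λ i → act? i ×-dec A? i ℓ ×-dec all? λ w → w ∈? Y →-dec A? i w →-dec w ≟ ℓ

  Avoiding : (Fin p → Set) → Fin m → Fin p → Set
  Avoiding act ℓ i = act i × ¬ A i ℓ

  subtrees-avoiding : ∀ {Y act ℓ} → Subtrees Y act → Subtrees (Y - ℓ) (Avoiding act ℓ)
  subtrees-avoiding subtrees (ai , ¬Aiℓ) = connected-≐
    (λ (x∈Y , Aix) → x∈p∧x≢y⇒x∈p-y x∈Y (λ { refl → ¬Aiℓ Aix }) , Aix)
    (λ (x∈Y-ℓ , Aix) → p─q⊆p _ _ x∈Y-ℓ , Aix)
    (subtrees ai)

  packing-cons : ∀ {Y act ℓ k} → SingletonTrace Y act ℓ →
                 Packing (Y - ℓ) (Avoiding act ℓ) k → Packing Y act (suc k)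
  packing-cons {Y} {act} {ℓ} {k} (i , ai , _ , only-ℓ) (f , avoiding , disjoint) =
    g , active , disjoint′
    where
    g : Fin (suc k) → Fin p
    g = i Vector.∷ f
    active : ∀ j → act (g j)
    active zero    = ai
    active (suc j) = proj₁ (avoiding j)
    disjoint′ : ∀ j j′ → j ≢ j′ → ∀ {x} → x ∈ Y → A (g j) x → A (g j′) x → ⊥
    disjoint′ zero    zero     j≢j  _   _   _  = j≢j refl
    disjoint′ zero    (suc j′) _    x∈Y Aix A′x =
      proj₂ (avoiding j′) (subst (A (f j′)) (only-ℓ _ x∈Y Aix) A′x)
    disjoint′ (suc j) zero     _    x∈Y Ax  Aix =
      proj₂ (avoiding j) (subst (A (f j)) (only-ℓ _ x∈Y Aix) Ax)
    disjoint′ (suc j) (suc j′) j≢j′ x∈Y Ax  A′x =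
      disjoint j j′ (j≢j′ ∘ cong suc) (x∈p∧x≢y⇒x∈p-y x∈Y (λ { refl → proj₂ (avoiding j) Ax }))
        Ax A′x

  transversal-cons : ∀ {act ℓ k} → Transversal (Avoiding act ℓ) k → Transversal act (suc k)
  transversal-cons {act} {ℓ} (xs , |xs|<k , hits) = ℓ ∷ xs , s≤s |xs|<k , hits′
    where
    hits′ : ∀ {i} → act i → Any (A i) (ℓ ∷ xs)
    hits′ {i} ai with A? i ℓ
    ... | yes Aiℓ = here Aiℓ
    ... | no ¬Aiℓ = there (hits (ai , ¬Aiℓ))

  neighbour-in-trace : ∀ {Y act ℓ} → ℓ ∈ Y → ¬ SingletonTrace Y act ℓ → Subtrees Y act →
                       ∀ {i} → act i → A i ℓ → ∃ λ q → Trace Y i q × Adj T ℓ q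
  neighbour-in-trace {Y} {act} {ℓ} ℓ∈Y ¬single subtrees {i} ai Aiℓ
    with any? (λ w → w ∈? Y ×-dec A? i w ×-dec ¬? (w ≟ ℓ))
  ... | yes (w , w∈Y , Aiw , w≢ℓ) =
    first-step (proj₂ (subtrees ai) ℓ w (ℓ∈Y , Aiℓ) (w∈Y , Aiw)) (w≢ℓ ∘ sym)
  ... | no none =
    ⊥-elim (¬single (i , ai , Aiℓ , λ w w∈Y Aiw →
      decidable-stable (w ≟ ℓ) (λ w≢ℓ → none (w , w∈Y , Aiw , w≢ℓ))))

  subtrees-minus-leaf : ∀ {Y act ℓ} → ℓ ∈ Y → LeafIn T (_∈ Y) ℓ → ¬ SingletonTrace Y act ℓ →
                        Subtrees Y act → Subtrees (Y - ℓ) act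
  subtrees-minus-leaf {Y} {act} {ℓ} ℓ∈Y leaf ¬single subtrees {i} ai = nonempty , walk
    where
    nonempty : ∃ (Trace (Y - ℓ) i)
    nonempty with proj₁ (subtrees ai)
    ... | u , u∈Y , Aiu with u ≟ ℓ
    ...   | no u≢ℓ = u , x∈p∧x≢y⇒x∈p-y u∈Y u≢ℓ , Aiu
    ...   | yes refl =
      let q , (q∈Y , Aiq) , ℓq = neighbour-in-trace ℓ∈Y ¬single subtrees ai Aiu
      in  q , x∈p∧x≢y⇒x∈p-y q∈Y (Adj⇒≢ T ℓq ∘ sym) , Aiq
    walk : ∀ u v → Trace (Y - ℓ) i u → Trace (Y - ℓ) i v → WalkIn (Adj T) (Trace (Y - ℓ) i) u v
    walk u v (u∈Y-ℓ , Aiu) (v∈Y-ℓ , Aiv) =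
      walk-map (λ ((x∈Y , Aix) , x≢ℓ) → x∈p∧x≢y⇒x∈p-y x∈Y x≢ℓ , Aix)
        (avoid-leaf T (λ (a∈Y , _) (b∈Y , _) → leaf a∈Y b∈Y)
          (proj₂ (subtrees ai) u v (p─q⊆p _ _ u∈Y-ℓ , Aiu) (p─q⊆p _ _ v∈Y-ℓ , Aiv))
          (x∈p-y⇒x≢y u∈Y-ℓ) (x∈p-y⇒x≢y v∈Y-ℓ))

  packing-minus-leaf : ∀ {Y act ℓ k} → ℓ ∈ Y → LeafIn T (_∈ Y) ℓ → ¬ SingletonTrace Y act ℓ →
                       Subtrees Y act → Packing (Y - ℓ) act k → Packing Y act k
  packing-minus-leaf {Y} {act} {ℓ} ℓ∈Y leaf ¬single subtrees (f , active , disjoint) =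
    f , active , disjoint′
    where
    disjoint′ : ∀ j j′ → j ≢ j′ → ∀ {x} → x ∈ Y → A (f j) x → A (f j′) x → ⊥
    disjoint′ j j′ j≢j′ {x} x∈Y Ax A′x with x ≟ ℓ
    ... | no x≢ℓ = disjoint j j′ j≢j′ (x∈p∧x≢y⇒x∈p-y x∈Y x≢ℓ) Ax A′x
    ... | yes refl =
      let q  , (q∈Y , Aq)    , ℓq  = neighbour-in-trace ℓ∈Y ¬single subtrees (active j) Ax
          q′ , (q′∈Y , A′q′) , ℓq′ = neighbour-in-trace ℓ∈Y ¬single subtrees (active j′) A′x
      in  disjoint j j′ j≢j′ (x∈p∧x≢y⇒x∈p-y q∈Y (Adj⇒≢ T ℓq ∘ sym)) Aq
            (subst (A (f j′)) (leaf q′∈Y q∈Y ℓq′ ℓq) A′q′)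

  packing-or-transversal : ∀ {Y} → Acc _⊂_ Y → ∀ {act} → (∀ i → Dec (act i)) → Subtrees Y act →
                           ∀ k → Packing Y act k ⊎ Transversal act k
  packing-or-transversal _ _ _ zero = inj₁ ((λ ()) , (λ ()) , λ ())
  packing-or-transversal {Y} (acc smaller) {act} act? subtrees (suc k) with nonempty? Y
  ... | no Y-empty =
    inj₂ ([] , s≤s z≤n , λ ai →
      let x , x∈Y , _ = proj₁ (subtrees ai) in ⊥-elim (Y-empty (x , x∈Y)))
  ... | yes (_ , y∈Y) with leaf-exists T acyclic Y y∈Y
  ... | ℓ , ℓ∈Y , leaf with singletonTrace? Y act? ℓ
  ... | yes single =
    Sum.map (packing-cons single) transversal-cons
      (packing-or-transversal (smaller (x∈p⇒p-x⊂p ℓ∈Y)) (λ i → act? i ×-dec ¬? (A? i ℓ))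
        (subtrees-avoiding subtrees) k)
  ... | no ¬single =
    Sum.map (packing-minus-leaf ℓ∈Y leaf ¬single subtrees) id
      (packing-or-transversal (smaller (x∈p⇒p-x⊂p ℓ∈Y)) act?
        (subtrees-minus-leaf ℓ∈Y leaf ¬single subtrees) (suc k))

pairwise-disjoint⇒injective : ∀ {n k p} {B : Fin p → Subset n} (f : Fin k → Fin p) →
  (∀ j → Nonempty (B (f j))) → (∀ j j′ → j ≢ j′ → Empty (B (f j) ∩ B (f j′))) →
  Injective _≡_ _≡_ f
pairwise-disjoint⇒injective {B = B} f nonempty disjoint {j} {j′} fj≡fj′ with j ≟ j′
... | yes j≡j′ = j≡j′
... | no  j≢j′ =
  let x , x∈Bfj = nonempty j
  in  ⊥-elim (disjoint j j′ j≢j′ (x , x∈p∩q⁺ (x∈Bfj , subst (λ i → x ∈ B i) fj≡fj′ x∈Bfj)))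

meets-⋃ : ∀ {n m} (P : Subset n) (W : Fin m → Subset n) {xs} →
          Any (λ x → Nonempty (P ∩ W x)) xs → Nonempty (P ∩ ⋃ (map W xs))
meets-⋃ P W {x ∷ _} (here (v , v∈P∩Wx)) =
  let v∈P , v∈Wx = x∈p∩q⁻ P (W x) v∈P∩Wx
  in  v , x∈p∩q⁺ (v∈P , x∈p∪q⁺ (inj₁ v∈Wx))
meets-⋃ P W {_ ∷ xs} (there hit) =
  let v , v∈P∩⋃ = meets-⋃ P W hit
      v∈P , v∈⋃ = x∈p∩q⁻ P (⋃ (map W xs)) v∈P∩⋃
  in  v , x∈p∩q⁺ (v∈P , x∈p∪q⁺ (inj₂ v∈⋃))

module DecompositionTraces {n} {G : Graph n} {S : Subset n} (𝒲 : TreeDecomposition G S)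
                           {p} (F : Fin p → Subgraph G)
                           (F-connected : ∀ i → ConnectedSubgraph (F i))
                           (F-meets-S : ∀ i → Nonempty (V (F i) ∩ S)) where

  open TreeDecomposition 𝒲

  Meets : Fin p → Fin m → Set
  Meets i x = Nonempty (V (F i) ∩ W x)

  meets? : ∀ i x → Dec (Meets i x)
  meets? i x = nonempty? (V (F i) ∩ W x)

  meets : ∀ {i u x} → u ∈ V (F i) → u ∈ W x → Meets i x
  meets {u = u} u∈F u∈Wx = u , x∈p∩q⁺ (u∈F , u∈Wx)

  FWalk : Fin p → Fin n → Fin n → Set
  FWalk i = WalkIn (λ u v → E (F i) u v ≡ true) (_∈ V (F i))

  edge⇒Adj : ∀ {i u v} → E (F i) u v ≡ true → Adj G u v
  edge⇒Adj {i} {u} {v} uv = proj₁ (E⊆ (F i) u v uv)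

  F-meets-U : ∀ i → ∃ λ s → s ∈ V (F i) × s ∈ U
  F-meets-U i =
    let s , s∈F∩S = F-meets-S i
        s∈F , s∈S = x∈p∩q⁻ (V (F i)) S s∈F∩S
    in  s , s∈F , S⊆U s∈S

  bag-walk : ∀ {i u x y} → u ∈ V (F i) → u ∈ W x → u ∈ W y → WalkIn (Adj T) (Meets i) x y
  bag-walk {u = u} {x} {y} u∈F u∈Wx u∈Wy =
    walk-map (meets u∈F) (proj₂ (subtree u (W⊆U x u∈Wx)) x y u∈Wx u∈Wy)

  Guards : Subset n → Fin m → Set
  Guards C x = ∀ u → u ∉ C → (∃ λ v → v ∈ C × Adj G u v) → u ∈ W x

  guarded-component : ∀ {v} → v ∉ U → ∃ λ C → IsComponentOfMinus G U C × v ∈ C × ∃ (Guards C)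
  guarded-component v∉U =
    let C , component , v∈C = component-containing G U v∉U
    in  C , component , v∈C , comp-cov C component

  data Anchor (v : Fin n) (x : Fin m) : Set where
    bag       : v ∈ W x → Anchor v x
    component : ∀ {C} → IsComponentOfMinus G U C → v ∈ C → Guards C x → Anchor v x

  anchor : ∀ v → ∃ (Anchor v)
  anchor v with v ∈? U
  ... | yes v∈U = let x , v∈Wx = proj₁ (subtree v v∈U) in x , bag v∈Wx
  ... | no  v∉U =
    let _ , isC , v∈C , x , guards = guarded-component v∉U
    in  x , component isC v∈C guards

  -- F i runs from C to S ⊆ U, so it leaves C through a neighbour of C.
  guarded-meets : ∀ {i C x u} → IsComponentOfMinus G U C → Guards C x → u ∈ C → u ∈ V (F i) →
                  Meets i x
  guarded-meets {i} {C} (C∩U=∅ , _) guards u∈C u∈F =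
    let s , s∈F , s∈U = F-meets-U i
        c , w , c∈C , w∉C , w∈F , cw =
          walk-exit C (proj₂ (F-connected i) _ s u∈F s∈F) u∈C (λ s∈C → C∩U=∅ s s∈C s∈U)
    in  meets w∈F (guards w w∉C (c , c∈C , Adj-sym G (edge⇒Adj cw)))

  anchor-meets : ∀ {i v x} → Anchor v x → v ∈ V (F i) → Meets i x
  anchor-meets (bag v∈Wx)                v∈F = meets v∈F v∈Wx
  anchor-meets (component isC v∈C guards) v∈F = guarded-meets isC guards v∈C v∈F

  anchor-step : ∀ {i u v x} → Anchor u x → u ∈ V (F i) → v ∈ V (F i) → Adj G u v →
                ∃ λ y → Anchor v y × WalkIn (Adj T) (Meets i) x y
  anchor-step {u = u} {v} {x} (bag u∈Wx) u∈F v∈F uv with v ∈? U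
  ... | yes v∈U =
    let y , u∈Wy , v∈Wy = edge-cov u v (W⊆U x u∈Wx) v∈U uv
    in  y , bag v∈Wy , bag-walk u∈F u∈Wx u∈Wy
  ... | no v∉U =
    let _ , isC , v∈C , y , guards = guarded-component v∉U
        u∈Wy = guards u (λ u∈C → proj₁ isC u u∈C (W⊆U x u∈Wx)) (v , v∈C , uv)
    in  y , component isC v∈C guards , bag-walk u∈F u∈Wx u∈Wy
  anchor-step {u = u} {v} {x} (component isC u∈C guards) u∈F v∈F uv with v ∈? U
  ... | yes v∈U =
    let v∈Wx = guards v (λ v∈C → proj₁ isC v v∈C v∈U) (u , u∈C , Adj-sym G uv)
    in  x , bag v∈Wx , here (meets v∈F v∈Wx)
  ... | no v∉U =
    x , component isC (proj₂ (proj₂ isC) u v u∈C v∉U uv) guards ,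
    here (guarded-meets isC guards u∈C u∈F)

  anchor-walk : ∀ {i u b x y} → FWalk i u b → Anchor u x → b ∈ W y → WalkIn (Adj T) (Meets i) x y
  anchor-walk (here b∈F) (bag b∈Wx) b∈Wy = bag-walk b∈F b∈Wx b∈Wy
  anchor-walk {y = y} (here _) (component (C∩U=∅ , _) b∈C _) b∈Wy =
    ⊥-elim (C∩U=∅ _ b∈C (W⊆U y b∈Wy))
  anchor-walk (step u∈F uv rest) anchor-u b∈Wy =
    let _ , anchor-v , walk = anchor-step anchor-u u∈F (walk-source rest) (edge⇒Adj uv)
    in  walk ++ʷ anchor-walk rest anchor-v b∈Wy

  meets-connected : ∀ i → ConnectedIn (Adj T) (Meets i)
  meets-connected i = nonempty , walk
    where
    nonempty : ∃ (Meets i)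
    nonempty =
      let s , s∈F , s∈U = F-meets-U i
          x , s∈Wx = proj₁ (subtree s s∈U)
      in  x , meets s∈F s∈Wx
    walk : ∀ x y → Meets i x → Meets i y → WalkIn (Adj T) (Meets i) x y
    walk x y (a , a∈F∩Wx) (b , b∈F∩Wy) =
      let a∈F , a∈Wx = x∈p∩q⁻ (V (F i)) (W x) a∈F∩Wx
          b∈F , b∈Wy = x∈p∩q⁻ (V (F i)) (W y) b∈F∩Wy
      in  anchor-walk (proj₂ (F-connected i) a b a∈F b∈F) (bag a∈Wx) b∈Wy

  disjoint-meets⇒disjoint : ∀ {i j} → (∀ {x} → Meets i x → Meets j x → ⊥) →
                            Empty (V (F i) ∩ V (F j))
  disjoint-meets⇒disjoint {i} {j} disjoint (v , v∈Fi∩Fj) =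
    let v∈Fi , v∈Fj = x∈p∩q⁻ (V (F i)) (V (F j)) v∈Fi∩Fj
        _ , anchor-v = anchor v
    in  disjoint (anchor-meets anchor-v v∈Fi) (anchor-meets anchor-v v∈Fj)

  open SubtreeHelly T (proj₂ T-tree) Meets meets? public

  Everyone : Fin p → Set
  Everyone _ = Unit.⊤

  meets-subtrees : Subtrees ⊤ Everyone
  meets-subtrees {i} _ = connected-≐ (∈⊤ ,_) proj₂ (meets-connected i)

  packing⇒disjoint-members : ∀ {k} → Packing ⊤ Everyone k →
    Σ (Fin k → Fin p) λ f → Injective _≡_ _≡_ f ×
      (∀ j j′ → j ≢ j′ → Empty (V (F (f j)) ∩ V (F (f j′))))
  packing⇒disjoint-members (f , _ , disjoint) =
    f , pairwise-disjoint⇒injective {B = V ∘ F} f nonempty F-disjoint , F-disjoint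
    where
    F-disjoint : ∀ j j′ → j ≢ j′ → Empty (V (F (f j)) ∩ V (F (f j′)))
    F-disjoint j j′ j≢j′ = disjoint-meets⇒disjoint (disjoint j j′ j≢j′ ∈⊤)
    nonempty : ∀ j → Nonempty (V (F (f j)))
    nonempty j = let s , s∈F , _ = F-meets-U (f j) in s , s∈F

  transversal⇒hitting-bags : ∀ {k} → Transversal Everyone (suc k) →
    Σ (Subset n) λ Z → Σ (List (Fin m)) λ xs →
      length xs ≤ k × Z ≡ ⋃ (map W xs) × (∀ i → Nonempty (V (F i) ∩ Z))
  transversal⇒hitting-bags (xs , |xs|<1+k , hits) =
    ⋃ (map W xs) , xs , ≤-pred |xs|<1+k , refl , λ i → meets-⋃ (V (F i)) W (hits {i} _)

lemma8p2 : ∀ {n} (G : Graph n) (S : Subset n) (𝒲 : TreeDecomposition G S)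
    (p : ℕ) (F : Fin p → Subgraph G) →
    (∀ i → ConnectedSubgraph (F i)) →
    (∀ i → Nonempty (V (F i) ∩ S)) →
    (k : ℕ) → 1 ≤ k →
    (Σ (Fin k → Fin p) λ f → Injective _≡_ _≡_ f ×
        (∀ i j → i ≢ j → Empty (V (F (f i)) ∩ V (F (f j)))))
    ⊎
    (Σ (Subset n) λ Z → Σ (List (Fin (TreeDecomposition.m 𝒲))) λ xs →
        length xs ≤ k ∸ 1 ×
        Z ≡ ⋃ (map (TreeDecomposition.W 𝒲) xs) ×
        (∀ i → Nonempty (V (F i) ∩ Z)))
lemma8p2 _ _ _ _ _ _ _ zero ()
lemma8p2 G S 𝒲 p F F-connected F-meets-S (suc k) _ =
  Sum.map packing⇒disjoint-members transversal⇒hitting-bags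
    (packing-or-transversal (⊂-wellFounded ⊤) (λ _ → yes tt) meets-subtrees (suc k))
  where open DecompositionTraces 𝒲 F F-connected F-meets-S
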